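{- There is no formula $\varphi\in\mathcal L_{\mathcal U}$ such that $\Box p\leftrightarrow\varphi$ is valid over the class of finite temporal here-and-there models (where $p$ is a propositional variable). That is, the connective $\Box$ is not $\mathcal L_{\mathcal U}$-definable, even over the class of finite here-and-there models.
   Context: Formulas of $\mathcal L$ are generated by $\varphi::=p\mid\bot\mid\varphi\wedge\varphi\mid\varphi\vee\varphi\mid\varphi\to\varphi\mid\bigcirc\varphi\mid\Diamond\varphi\mid\Box\varphi\mid\varphi\,\mathcal U\,\varphi\mid\varphi\,\mathcal R\,\varphi$, with $p$ ranging over a countable set of propositional variables; $\neg\varphi:=\varphi\to\bot$, $\top:=\neg\bot$, $\varphi\leftrightarrow\psi:=(\varphi\to\psi)\wedge(\psi\to\varphi)$. $\mathcal L_{\mathcal U}$ is the fragment built from variables, $\bot,\wedge,\vee,\to,\bigcirc$ and $\mathcal U$ only. A dynamic poset is $(W,\preccurlyeq,S)$ with $W\ne\emptyset$, $\preccurlyeq$ a partial order and $S:W\to W$ such that $w\preccurlyeq v$ implies $S(w)\preccurlyeq S(v)$. A model is $(W,\preccurlyeq,S,V)$ with $(W,\preccurlyeq,S)$ a dynamic poset and $V$ assigning to each world a set of variables with $w\preccurlyeq v\Rightarrow V(w)\subseteq V(v)$. Satisfaction: $w\models p$ iff $p\in V(w)$; $w\not\models\bot$; $\wedge,\vee$ classical; $w\models\varphi\to\psi$ iff for all $v\succcurlyeq w$, $v\models\varphi$ implies $v\models\psi$; $w\models\bigcirc\varphi$ iff $S(w)\models\varphi$; $w\models\Diamond\varphi$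 iff $S^k(w)\models\varphi$ for some $k\ge0$; $w\models\Box\varphi$ iff $S^k(w)\models\varphi$ for all $k\ge0$; $w\models\varphi\,\mathcal U\,\psi$ iff there is $k\ge0$ with $S^k(w)\models\psi$ and $S^i(w)\models\varphi$ for all $i\in[0,k)$; $w\models\varphi\,\mathcal R\,\psi$ iff for all $k\ge0$, either $S^k(w)\models\psi$ or $S^i(w)\models\varphi$ for some $i\in[0,k)$. A formula is valid over a class of models if it holds at every world of every model in the class. A temporal here-and-there frame is a dynamic poset $(W,\preccurlyeq,S)$ with $W=T\times\{0,1\}$ for some set $T$ and a function $f:T\to T$ such that $(t,i)\preccurlyeq(s,j)$ iff $t=s$ and $i\le j$, and $S(t,i)=(f(t),i)$; a here-and-there model is a model on such a frame; it is finite if $W$ is finite. -}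

module Defs where

open import Data.Nat using (ℕ; zero; suc; _<_)
open import Data.Bool using (Bool; true; false)
open import Data.Bool.Base using () renaming (_≤_ to _≤ᵇ_)
import Data.Bool.Properties as BP
open import Data.Fin using (Fin)
open import Data.Product using (Σ; ∃; _×_; _,_; proj₁; proj₂)
open import Data.Sum using (_⊎_)
open import Data.Empty using (⊥)
open import Relation.Binary.PropositionalEquality using (_≡_; refl; sym; trans; cong; cong₂; isEquivalence)
open import Relation.Binary.Structures using (IsPartialOrder; IsPreorder)

Var : Set
Var = ℕ

data Formula : Set where
  var  : Var → Formula
  ⊥'   : Formula
  _∧'_ : Formula → Formula → Formula
  _∨'_ : Formula → Formula → Formula
  _⇒_  : Formula → Formula → Formula
  ○    : Formula → Formula
  ◇    : Formula → Formula
  □    : Formula → Formula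
  _𝒰_  : Formula → Formula → Formula
  _ℛ_  : Formula → Formula → Formula

¬' : Formula → Formula
¬' φ = φ ⇒ ⊥'

⊤' : Formula
⊤' = ¬' ⊥'

_⇔'_ : Formula → Formula → Formula
φ ⇔' ψ = (φ ⇒ ψ) ∧' (ψ ⇒ φ)

data InLU : Formula → Set where
  var  : ∀ p → InLU (var p)
  ⊥'   : InLU ⊥'
  _∧'_ : ∀ {φ ψ} → InLU φ → InLU ψ → InLU (φ ∧' ψ)
  _∨'_ : ∀ {φ ψ} → InLU φ → InLU ψ → InLU (φ ∨' ψ)
  _⇒_  : ∀ {φ ψ} → InLU φ → InLU ψ → InLU (φ ⇒ ψ)
  ○    : ∀ {φ} → InLU φ → InLU (○ φ)
  _𝒰_  : ∀ {φ ψ} → InLU φ → InLU ψ → InLU (φ 𝒰 ψ)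

-- Models (W, ≼, S, V) on dynamic posets.  A valuation is given as the
-- characteristic function of the set of variables true at a world.
record Model : Set₁ where
  field
    W      : Set
    _≼_    : W → W → Set
    S      : W → W
    V      : W → Var → Bool
    isPO   : IsPartialOrder _≡_ _≼_
    S-mono : ∀ {w v} → w ≼ v → S w ≼ S v
    V-mono : ∀ {w v} (p : Var) → w ≼ v → V w p ≡ true → V v p ≡ true

iter : {A : Set} → (A → A) → ℕ → A → A
iter g zero    a = a
iter g (suc k) a = g (iter g k a)

_,_⊨_ : (M : Model) → Model.W M → Formula → Set
M , w ⊨ var p   = Model.V M w p ≡ true
M , w ⊨ ⊥'      = ⊥
M , w ⊨ (φ ∧' ψ) = (M , w ⊨ φ) × (M , w ⊨ ψ)
M , w ⊨ (φ ∨' ψ) = (M , w ⊨ φ) ⊎ (M , w ⊨ ψ)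
M , w ⊨ (φ ⇒ ψ)  = ∀ v → Model._≼_ M w v → M , v ⊨ φ → M , v ⊨ ψ
M , w ⊨ ○ φ     = M , Model.S M w ⊨ φ
M , w ⊨ ◇ φ     = Σ ℕ λ k → M , iter (Model.S M) k w ⊨ φ
M , w ⊨ □ φ     = ∀ (k : ℕ) → M , iter (Model.S M) k w ⊨ φ
M , w ⊨ (φ 𝒰 ψ)  = Σ ℕ λ k → (M , iter (Model.S M) k w ⊨ ψ)
                     × (∀ i → i < k → M , iter (Model.S M) i w ⊨ φ)
M , w ⊨ (φ ℛ ψ)  = ∀ (k : ℕ) → (M , iter (Model.S M) k w ⊨ ψ)
                     ⊎ (Σ ℕ λ i → i < k × M , iter (Model.S M) i w ⊨ φ)

-- Temporal here-and-there frames with T = Fin n (finite case):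
-- W = T × {0,1} with 0 = false, 1 = true;
-- (t,i) ≼ (s,j) iff t = s and i ≤ j;  S (t,i) = (f t, i).
HTWorld : ℕ → Set
HTWorld n = Fin n × Bool

_≼HT_ : ∀ {n} → HTWorld n → HTWorld n → Set
(t , i) ≼HT (s , j) = (t ≡ s) × (i ≤ᵇ j)

SHT : ∀ {n} → (Fin n → Fin n) → HTWorld n → HTWorld n
SHT f (t , i) = (f t , i)

≼HT-isPO : ∀ {n} → IsPartialOrder (_≡_ {A = HTWorld n}) _≼HT_
≼HT-isPO = record
  { isPreorder = record
    { isEquivalence = isEquivalence
    ; reflexive = λ { refl → refl , BP.≤-refl }
    ; trans = λ { (refl , a) (refl , b) → refl , BP.≤-trans a b }
    }
  ; antisym = λ { (refl , a) (_ , b) → cong₂ _,_ refl (BP.≤-antisym a b) }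
  }

HTModel : (n : ℕ) (f : Fin n → Fin n) (V : HTWorld n → Var → Bool)
          → (∀ {w v} (p : Var) → w ≼HT v → V w p ≡ true → V v p ≡ true)
          → Model
HTModel n f V mono = record
  { W = HTWorld n
  ; _≼_ = _≼HT_
  ; S = SHT f
  ; V = V
  ; isPO = ≼HT-isPO
  ; S-mono = λ { (refl , a) → refl , a }
  ; V-mono = mono
  }

ValidFinHT : Formula → Set
ValidFinHT φ = ∀ (n : ℕ) (f : Fin n → Fin n) (V : HTWorld n → Var → Bool)
  (mono : ∀ {w v} (p : Var) → w ≼HT v → V w p ≡ true → V v p ≡ true)
  (w : HTWorld n) → HTModel n f V mono , w ⊨ φ

module Submission where

-- For d ∈ ℕ consider the countdown model on T = Fin (d + 2) with
-- f = pred (a countdown stuck at 0): every variable is true at every "there"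
-- world (t,1), and at every "here" world (t,0) except (0,0).  Started at
-- t₀ = d + 1, the formula □ p holds at (t₀,1) but fails at (t₀,0), because
-- the countdown reaches 0 after d + 1 steps.  On the other hand an L_U formula
-- φ with ○-depth d cannot see that far: as long as the first d + 1 states of
-- the run from t are "safe" (all variables true there as well), truth of φ
-- transfers from (t,1) down to (t,0).  The 𝒰 case is the heart of this: the
-- there-worlds are all alike, so an until can always be fulfilled at once.

open import Defs
open import Data.Product using (Σ; _×_; _,_; proj₁; proj₂)
open import Data.Nat using (ℕ; zero; suc; _<_; _≤_; _⊔_; s≤s)
open import Data.Nat.Properties using (m≤m⊔n; m≤n⊔m; n<1+n)
open import Data.Bool using (Bool; true; false; _∨_)
open import Data.Bool.Base using (b≤b; f≤t)
import Data.Bool.Properties as BoolP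
open import Data.Fin using (Fin; zero; suc; pred; inject₁; toℕ; fromℕ)
open import Data.Fin.Properties using (toℕ-inject₁; toℕ-fromℕ)
open import Data.Sum using (inj₁; inj₂)
open import Relation.Nullary using (¬_)
open import Relation.Binary.Structures using (IsPartialOrder)
open import Relation.Binary.PropositionalEquality
  using (_≡_; refl; sym; trans; cong; cong₂; subst)

iter-suc : {A : Set} (g : A → A) (k : ℕ) (a : A) → iter g (suc k) a ≡ iter g k (g a)
iter-suc g zero    a = refl
iter-suc g (suc k) a = cong g (iter-suc g k a)

module Persistence (M : Model) where
  open Model M
  open IsPartialOrder isPO using () renaming (trans to ≼-trans)

  iter-mono : ∀ k {w v} → w ≼ v → iter S k w ≼ iter S k v
  iter-mono zero    w≼v = w≼v
  iter-mono (suc k) w≼v = S-mono (iter-mono k w≼v)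

  persistence : ∀ φ {w v} → w ≼ v → M , w ⊨ φ → M , v ⊨ φ
  persistence (var p)  w≼v h = V-mono p w≼v h
  persistence (φ ∧' ψ) w≼v (hφ , hψ) = persistence φ w≼v hφ , persistence ψ w≼v hψ
  persistence (φ ∨' ψ) w≼v (inj₁ h) = inj₁ (persistence φ w≼v h)
  persistence (φ ∨' ψ) w≼v (inj₂ h) = inj₂ (persistence ψ w≼v h)
  persistence (φ ⇒ ψ)  w≼v h u v≼u = h u (≼-trans w≼v v≼u)
  persistence (○ φ)    w≼v h = persistence φ (S-mono w≼v) h
  persistence (◇ φ)    w≼v (k , h) = k , persistence φ (iter-mono k w≼v) h
  persistence (□ φ)    w≼v h k = persistence φ (iter-mono k w≼v) (h k)
  persistence (φ 𝒰 ψ)  w≼v (k , hψ , hφ) =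
    k , persistence ψ (iter-mono k w≼v) hψ , λ i i<k → persistence φ (iter-mono i w≼v) (hφ i i<k)
  persistence (φ ℛ ψ)  w≼v h k with h k
  ... | inj₁ hψ            = inj₁ (persistence ψ (iter-mono k w≼v) hψ)
  ... | inj₂ (i , i<k , hφ) = inj₂ (i , i<k , persistence φ (iter-mono i w≼v) hφ)

nextDepth : ∀ {φ} → InLU φ → ℕ
nextDepth (var p) = 0
nextDepth ⊥'      = 0
nextDepth (a ∧' b) = nextDepth a ⊔ nextDepth b
nextDepth (a ∨' b) = nextDepth a ⊔ nextDepth b
nextDepth (a ⇒ b)  = nextDepth a ⊔ nextDepth b
nextDepth (○ a)    = suc (nextDepth a)
nextDepth (a 𝒰 b)  = nextDepth a ⊔ nextDepth b

module Uniform (n : ℕ) (f : Fin n → Fin n) (H : Fin n → Bool) where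

  val : HTWorld n → Var → Bool
  val (t , b) _ = b ∨ H t

  val-mono : ∀ {w v} (p : Var) → w ≼HT v → val w p ≡ true → val v p ≡ true
  val-mono {t , b} {.t , .b}   p (refl , b≤b) h = h
  val-mono {t , _} {.t , true} p (refl , f≤t) h = refl

  model : Model
  model = HTModel n f val val-mono

  open Persistence model using (persistence)

  _⊩_ : HTWorld n → Formula → Set
  w ⊩ φ = model , w ⊨ φ

  ≼-refl : ∀ {w : HTWorld n} → w ≼HT w
  ≼-refl = refl , BoolP.≤-refl

  There : HTWorld n → Set
  There w = proj₂ w ≡ true

  iter-fst : ∀ k w → proj₁ (iter (SHT f) k w) ≡ iter f k (proj₁ w)
  iter-fst zero    w = refl
  iter-fst (suc k) w = cong f (iter-fst k w)

  iter-snd : ∀ k w → proj₂ (iter (SHT f) k w) ≡ proj₂ w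
  iter-snd zero    w = refl
  iter-snd (suc k) w = iter-snd k w

  iter-there : ∀ k {w} → There w → There (iter (SHT f) k w)
  iter-there k {w} = trans (iter-snd k w)

  above-there : ∀ {w v} → There w → w ≼HT v → There v
  above-there {_ , true} {_ , true} _ _ = refl

  there-val : ∀ {w} (p : Var) → There w → val w p ≡ true
  there-val {_ , true} p _ = refl

  -- All there-worlds satisfy the same formulas of L: they carry the same
  -- valuation, have no proper ≼-successor, and S maps them to there-worlds.
  thereAgree : ∀ φ {u v} → There u → There v → u ⊩ φ → v ⊩ φ
  thereAgree (var p)  _  tv _ = there-val p tv
  thereAgree (φ ∧' ψ) tu tv (hφ , hψ) = thereAgree φ tu tv hφ , thereAgree ψ tu tv hψ
  thereAgree (φ ∨' ψ) tu tv (inj₁ h) = inj₁ (thereAgree φ tu tv h)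
  thereAgree (φ ∨' ψ) tu tv (inj₂ h) = inj₂ (thereAgree ψ tu tv h)
  thereAgree (φ ⇒ ψ) {u} tu tv h x v≼x hφ =
    thereAgree ψ tu tx (h u ≼-refl (thereAgree φ tx tu hφ))
    where tx = above-there tv v≼x
  thereAgree (○ φ)    tu tv h = thereAgree φ tu tv h
  thereAgree (◇ φ)    tu tv (k , h) = k , thereAgree φ (iter-there k tu) (iter-there k tv) h
  thereAgree (□ φ)    tu tv h k = thereAgree φ (iter-there k tu) (iter-there k tv) (h k)
  thereAgree (φ 𝒰 ψ)  tu tv (k , hψ , hφ) =
    k , thereAgree ψ (iter-there k tu) (iter-there k tv) hψ
      , λ i i<k → thereAgree φ (iter-there i tu) (iter-there i tv) (hφ i i<k)
  thereAgree (φ ℛ ψ)  tu tv h k with h k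
  ... | inj₁ hψ            = inj₁ (thereAgree ψ (iter-there k tu) (iter-there k tv) hψ)
  ... | inj₂ (i , i<k , hφ) = inj₂ (i , i<k , thereAgree φ (iter-there i tu) (iter-there i tv) hφ)

  box-there : ∀ p t → (t , true) ⊩ □ (var p)
  box-there p t k = there-val p (iter-there k refl)

  box-fails-here : ∀ p k t → H (iter f k t) ≡ false → ¬ ((t , false) ⊩ □ (var p))
  box-fails-here p k t notH h with trans (sym here-false) (h k)
    where
    here-false : val (iter (SHT f) k (t , false)) p ≡ false
    here-false = trans (cong₂ (λ b s → b ∨ H s) (iter-snd k (t , false)) (iter-fst k (t , false))) notH
  ... | ()

  Safe : ℕ → Fin n → Set
  Safe zero    t = H t ≡ true
  Safe (suc d) t = (H t ≡ true) × Safe d (f t)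

  safe-mono : ∀ {d e} t → d ≤ e → Safe e t → Safe d t
  safe-mono {zero}  {zero}  t _ s = s
  safe-mono {zero}  {suc e} t _ s = proj₁ s
  safe-mono {suc d} {suc e} t (s≤s d≤e) (h , s) = h , safe-mono (f t) d≤e s

  -- An until is fulfilled immediately at (t,1), since all
  -- there-worlds agree; implications use persistence for the antecedent.
  transfer : ∀ {φ} (lu : InLU φ) t → Safe (nextDepth lu) t → (t , true) ⊩ φ → (t , false) ⊩ φ
  transfer (var p) t s _ = s
  transfer (a ∧' b) t s (ha , hb) =
    transfer a t (safe-mono t (m≤m⊔n _ _) s) ha , transfer b t (safe-mono t (m≤n⊔m _ _) s) hb
  transfer (a ∨' b) t s (inj₁ h) = inj₁ (transfer a t (safe-mono t (m≤m⊔n _ _) s) h)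
  transfer (a ∨' b) t s (inj₂ h) = inj₂ (transfer b t (safe-mono t (m≤n⊔m _ _) s) h)
  transfer (a ⇒ b) t _ h (.t , true)  (refl , _)   ha = h (t , true) ≼-refl ha
  transfer {φ ⇒ _} (a ⇒ b) t s h (.t , false) (refl , b≤b) ha =
    transfer b t (safe-mono t (m≤n⊔m _ _) s) (h (t , true) ≼-refl (persistence φ (refl , f≤t) ha))
  transfer (○ a) t (_ , s) h = transfer a (f t) s h
  transfer {_ 𝒰 ψ} (a 𝒰 b) t s (k , hψ , _) =
    0 , transfer b t (safe-mono t (m≤n⊔m _ _) s) (thereAgree ψ (iter-there k refl) refl hψ) , λ _ ()

nonzero : ∀ {n} → Fin n → Bool
nonzero zero    = false
nonzero (suc _) = true

module Countdown (n : ℕ) where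
  open Uniform n pred nonzero

  safe-above : ∀ d (t : Fin n) → d < toℕ t → Safe d t
  safe-above zero    (suc t) _ = refl
  safe-above (suc d) (suc t) (s≤s d<t) =
    refl , safe-above d (inject₁ t) (subst (d <_) (sym (toℕ-inject₁ t)) d<t)

  reaches-zero : ∀ k (t : Fin n) → toℕ t ≡ k → nonzero (iter pred k t) ≡ false
  reaches-zero zero    zero    _ = refl
  reaches-zero (suc k) (suc t) refl =
    trans (cong nonzero (iter-suc pred k (suc t))) (reaches-zero k (inject₁ t) (toℕ-inject₁ t))

mainTheorem1 : (p : Var) → ¬ (Σ Formula λ φ → InLU φ × ValidFinHT (□ (var p) ⇔' φ))
mainTheorem1 p (φ , lu , valid) = box-fails-here p (suc d) t₀ fails-at-zero box-here
  where
  d : ℕ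
  d = nextDepth lu

  n : ℕ
  n = suc (suc d)

  open Uniform n pred nonzero
  open Countdown n

  t₀ : Fin n
  t₀ = fromℕ (suc d)

  equiv : ∀ b → (t₀ , b) ⊩ (□ (var p) ⇔' φ)
  equiv b = valid n pred val val-mono (t₀ , b)

  φ-there : (t₀ , true) ⊩ φ
  φ-there = proj₁ (equiv true) (t₀ , true) ≼-refl (box-there p t₀)

  φ-here : (t₀ , false) ⊩ φ
  φ-here = transfer lu t₀ (safe-above d t₀ (subst (d <_) (sym (toℕ-fromℕ (suc d))) (n<1+n d))) φ-there

  box-here : (t₀ , false) ⊩ □ (var p)
  box-here = proj₂ (equiv false) (t₀ , false) ≼-refl φ-here

  fails-at-zero : nonzero (iter pred (suc d) t₀) ≡ false
  fails-at-zero = reaches-zero (suc d) t₀ (toℕ-fromℕ (suc d))
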